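{- Let $\mathbf{S}$ be a distributive meet semilattice, let $n \geq 1$ be an integer, and let $U \subseteq \mathbf{S}$ be an upset. Let $\mathrm{Fg}_n(U)$ denote the smallest $n$-filter of $\mathbf{S}$ containing $U$. Then for every $a \in \mathbf{S}$: $a \in \mathrm{Fg}_n(U)$ if and only if there is a non-empty finite set $X \subseteq U$ such that $\bigwedge Y \in U$ for every $Y \subseteq X$ with $1 \leq |Y| \leq n$, and $\bigwedge X \leq a$. Moreover, the same equivalence holds with the condition $\bigwedge X \leq a$ replaced by $\bigwedge X = a$.
   Context: A meet semilattice $\mathbf{S}$ is distributive if whenever $x \wedge y \leq z$ there exist $x' \geq x$ and $y' \geq y$ with $x' \wedge y' = z$. For an integer $n \geq 1$, an $n$-filter of a meet semilattice $\mathbf{S}$ is an upset $F \subseteq \mathbf{S}$ such that for every non-empty finite $X \subseteq \mathbf{S}$: if $\bigwedge Y \in F$ for every $Y \subseteq X$ with $1 \leq |Y| \leq n$, then $\bigwedge X \in F$. The $n$-filters of $\mathbf{S}$ are closed under arbitrary intersections, so the smallest $n$-filter containing a given set exists. -}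

module Defs where

open import Level using (Level; _⊔_)
open import Data.Nat using (ℕ; _≤_)
open import Data.Product using (Σ; ∃; _×_; _,_)
open import Data.List using (List; length)
open import Data.List.NonEmpty using (List⁺; toList; foldr₁)
open import Data.List.Relation.Unary.All using (All)
open import Data.List.Membership.Propositional using (_∈_)
open import Relation.Unary using (Pred; _⊆_)
open import Relation.Binary.Lattice.Bundles using (MeetSemilattice)

module _ {c ℓ₁ ℓ₂ : Level} (S : MeetSemilattice c ℓ₁ ℓ₂) where
  open MeetSemilattice S renaming (_≤_ to _⊑_)

  IsDistributive : Set (c ⊔ ℓ₁ ⊔ ℓ₂)
  IsDistributive = ∀ x y z → (x ∧ y) ⊑ z →
    Σ Carrier λ x' → Σ Carrier λ y' → x ⊑ x' × y ⊑ y' × (x' ∧ y') ≈ z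

  IsUpset : ∀ {ℓ} → Pred Carrier ℓ → Set (c ⊔ ℓ₂ ⊔ ℓ)
  IsUpset U = ∀ {x y} → x ⊑ y → U x → U y

  -- meet of a non-empty finite set, given as a non-empty list of its elements
  ⋀ : List⁺ Carrier → Carrier
  ⋀ = foldr₁ _∧_

  _⊆ₗ_ : List⁺ Carrier → List⁺ Carrier → Set c
  Y ⊆ₗ X = All (λ y → y ∈ toList X) (toList Y)

  -- for all Y ⊆ X with 1 ≤ |Y| ≤ n, ⋀ Y ∈ F   (non-emptiness of Y is built into List⁺)
  SmallMeetsIn : ∀ {ℓ} → ℕ → Pred Carrier ℓ → List⁺ Carrier → Set (c ⊔ ℓ)
  SmallMeetsIn n F X = ∀ (Y : List⁺ Carrier) → Y ⊆ₗ X → length (toList Y) ≤ n → F (⋀ Y)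

  IsNFilter : ∀ {ℓ} → ℕ → Pred Carrier ℓ → Set (c ⊔ ℓ₂ ⊔ ℓ)
  IsNFilter n F = IsUpset F × (∀ (X : List⁺ Carrier) → SmallMeetsIn n F X → F (⋀ X))

  -- the smallest n-filter containing U: intersection of all n-filters containing U
  -- (quantifying over all predicates at level c ⊔ ℓ₂ ⊔ ℓ)
  Fg : ∀ {ℓ} → ℕ → Pred Carrier ℓ → Pred Carrier (Level.suc (c ⊔ ℓ₂ ⊔ ℓ))
  Fg {ℓ} n U a = ∀ (F : Pred Carrier (c ⊔ ℓ₂ ⊔ ℓ)) → IsNFilter n F → U ⊆ F → F a

-- Let H be the set of all a with ⋀ X ≤ a for some finite X ⊆ U whose meets of at most n
-- elements lie in U. Clearly U ⊆ H ⊆ Fgₙ(U), so it suffices that H is an n-filter. Let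
-- X = {x₁, …, x_k} have all its ≤ n-element meets ⋀ Y in H, with witnesses V_Y. Distributivity
-- (in the form: ⋀ A ≤ b makes b the meet of elements each above b and above some element of A)
-- refines each x_j into a finite G_j with ⋀ G_j ≤ x_j, every element of which lies above some
-- element of V_Y for every Y ∋ x_j. Then Z = ⋃ G_j has ⋀ Z ≤ ⋀ X, and any n elements of Z come
-- from at most n of the G_j, so they lie above elements of one V_Y and their meet is in U.
-- The same form of distributivity upgrades ⋀ X ≤ a to an X' with ⋀ X' = a.
module Submission where

open import Defs
open import Level using (_⊔_)
open import Data.Nat using (ℕ; _≤_; zero; suc; s≤s; _≤?_)
open import Data.Nat.Properties using (≤-trans; ≤-reflexive)
open import Data.Fin using (Fin; _≟_) renaming (zero to fzero; suc to fsuc)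
open import Data.Product using (Σ; ∃-syntax; _×_; _,_; proj₁; proj₂)
open import Data.List using (List; []; _∷_; [_]; length; map; concatMap; filter; tabulate; allFin; lookup)
open import Data.List.Properties using (length-map; tabulate-lookup)
open import Data.List.NonEmpty using (List⁺; toList; _∷_; _⁺++⁺_; _⁺++_)
open import Data.List.Relation.Unary.All using (All; []; _∷_)
import Data.List.Relation.Unary.All as All
open import Data.List.Relation.Unary.All.Properties using (++⁺; map⁺; tabulate⁺)
open import Data.List.Relation.Unary.Any using (here; there; any?)
open import Data.List.Membership.Propositional using (_∈_; lose; find)
open import Data.List.Membership.Propositional.Properties
  using (∈-map⁺; ∈-lookup; ∈-allFin; ∈-concatMap⁺; ∈-concatMap⁻; ∈-++⁺ˡ; ∈-++⁺ʳ; ∈-filter⁺; ∈-filter⁻)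
open import Relation.Unary using (Pred; Decidable)
open import Relation.Nullary using (yes; no; contradiction)
open import Relation.Nullary.Decidable using (_×-dec_)
open import Relation.Binary.PropositionalEquality as ≡ using (_≡_; cong; subst)
open import Relation.Binary.Lattice.Bundles using (MeetSemilattice)
open import Function.Base using (_∘_)
open import Function.Bundles using (_⇔_; mk⇔)

module _ {a b r} {A : Set a} {B : Set b} {R : A → B → Set r} where

  choices : ∀ {xs} → All (λ x → Σ B (R x)) xs → List B
  choices []             = []
  choices ((y , _) ∷ ps) = y ∷ choices ps

  length-choices : ∀ {xs} (ps : All (λ x → Σ B (R x)) xs) → length (choices ps) ≡ length xs
  length-choices []       = ≡.refl
  length-choices (_ ∷ ps) = cong suc (length-choices ps)

  choices-cover : ∀ {xs} (ps : All (λ x → Σ B (R x)) xs) →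
    All (λ x → ∃[ y ] y ∈ choices ps × R x y) xs
  choices-cover []             = []
  choices-cover ((y , r) ∷ ps) =
    (y , here ≡.refl , r) ∷ All.map (λ (y' , y'∈ , r') → y' , there y'∈ , r') (choices-cover ps)

  choices-sound : ∀ {xs} (ps : All (λ x → Σ B (R x)) xs) → All (λ y → ∃[ x ] R x y) (choices ps)
  choices-sound []             = []
  choices-sound ((y , r) ∷ ps) = (_ , r) ∷ choices-sound ps

words : ∀ {a} {A : Set a} → List A → ℕ → List (List A)
words as zero    = [ [] ]
words as (suc m) = [] ∷ concatMap (λ x → map (x ∷_) (words as m)) as

∈-words : ∀ {a} {A : Set a} (as : List A) m {l} → All (_∈ as) l → length l ≤ m → l ∈ words as m
∈-words as zero    []          _       = here ≡.refl
∈-words as (suc m) []          _       = here ≡.refl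
∈-words as (suc m) (x∈as ∷ l⊆) (s≤s l≤m) =
  there (∈-concatMap⁺ _ (lose x∈as (∈-map⁺ (_ ∷_) (∈-words as m l⊆ l≤m))))

module MeetProperties {c ℓ₁ ℓ₂} (S : MeetSemilattice c ℓ₁ ℓ₂) where
  open MeetSemilattice S renaming (_≤_ to _⊑_)

  ⋀-lowerBound : ∀ X {x} → x ∈ toList X → ⋀ S X ⊑ x
  ⋀-lowerBound (x ∷ [])     (here ≡.refl) = refl
  ⋀-lowerBound (x ∷ y ∷ ys) (here ≡.refl) = x∧y≤x _ _
  ⋀-lowerBound (x ∷ y ∷ ys) (there p)   = trans (x∧y≤y _ _) (⋀-lowerBound (y ∷ ys) p)

  ⋀-greatest : ∀ X {z} → All (z ⊑_) (toList X) → z ⊑ ⋀ S X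
  ⋀-greatest (x ∷ [])     (p ∷ [])  = p
  ⋀-greatest (x ∷ y ∷ ys) (p ∷ ps) = ∧-greatest p (⋀-greatest (y ∷ ys) ps)

  ⋀-antitone : ∀ X Y → All (_∈ toList X) (toList Y) → ⋀ S X ⊑ ⋀ S Y
  ⋀-antitone X Y Y⊆X = ⋀-greatest Y (All.map (⋀-lowerBound X) Y⊆X)

  ⋀-⁺++⁺ : ∀ X Y → ⋀ S (X ⁺++⁺ Y) ⊑ ⋀ S X ∧ ⋀ S Y
  ⋀-⁺++⁺ X Y = ∧-greatest (⋀-antitone (X ⁺++⁺ Y) X (All.tabulate ∈-++⁺ˡ))
                          (⋀-antitone (X ⁺++⁺ Y) Y (All.tabulate (∈-++⁺ʳ (toList X))))

  smallMeetsIn⇒All : ∀ {ℓ n} {U : Pred Carrier ℓ} → 1 ≤ n → ∀ X → SmallMeetsIn S n U X → All U (toList X)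
  smallMeetsIn⇒All 1≤n X small = All.tabulate (λ x∈X → small (_ ∷ []) (x∈X ∷ []) 1≤n)

  ↑ : List⁺ Carrier → Pred Carrier (c ⊔ ℓ₂)
  ↑ A x = ∃[ a ] a ∈ toList A × a ⊑ x

  ↑-isUpset : ∀ A → IsUpset S (↑ A)
  ↑-isUpset A x⊑y (a , a∈A , a⊑x) = a , a∈A , trans a⊑x x⊑y

  ↑-here : ∀ {a as x} → a ⊑ x → ↑ (a ∷ as) x
  ↑-here a⊑x = _ , here ≡.refl , a⊑x

  ↑-there : ∀ {a a' as x} → ↑ (a' ∷ as) x → ↑ (a ∷ a' ∷ as) x
  ↑-there (a'' , a''∈ , a''⊑x) = a'' , there a''∈ , a''⊑x

  ↑-trans : ∀ {A B x} → All (↑ B) (toList A) → ↑ A x → ↑ B x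
  ↑-trans A⊆↑B (a , a∈A , a⊑x) = ↑-isUpset _ a⊑x (All.lookup A⊆↑B a∈A)

  ↑-lowerBound : ∀ {A b x} → All (b ⊑_) (toList A) → ↑ A x → b ⊑ x
  ↑-lowerBound b⊑A (a , a∈A , a⊑x) = trans (All.lookup b⊑A a∈A) a⊑x

  -- Choosing below each element of W an element of V gives a subset of V of size at most |W|.
  smallMeet-↑ : ∀ {ℓ n} {U : Pred Carrier ℓ} → IsUpset S U → ∀ {V} → SmallMeetsIn S n U V →
    ∀ W → All (↑ V) (toList W) → length (toList W) ≤ n → U (⋀ S W)
  smallMeet-↑ U-upset small W W⊆↑V@((b , _) ∷ ps) |W|≤n =
    U-upset (⋀-greatest W (All.map (λ (_ , b∈B , _ , b⊑w) → trans (⋀-lowerBound B b∈B) b⊑w)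
                                   (choices-cover W⊆↑V)))
            (small B (All.map (λ (_ , b∈V , _) → b∈V) (choices-sound W⊆↑V))
                     (≤-trans (≤-reflexive (length-choices W⊆↑V)) |W|≤n))
    where
    B : List⁺ Carrier
    B = b ∷ choices ps

module DistributiveProperties {c ℓ₁ ℓ₂} (S : MeetSemilattice c ℓ₁ ℓ₂) (distrib : IsDistributive S) where
  open MeetSemilattice S renaming (_≤_ to _⊑_)
  open MeetProperties S
  open import Relation.Binary.Lattice.Properties.MeetSemilattice S using (∧-monotonic)

  ⋀-decompose : ∀ A {b} → ⋀ S A ⊑ b →
    Σ (List⁺ Carrier) λ B → ⋀ S B ⊑ b × All (λ b' → b ⊑ b' × ↑ A b') (toList B)
  ⋀-decompose (a ∷ as) = decompose a as
    where
    decompose : ∀ a as {b} → ⋀ S (a ∷ as) ⊑ b →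
      Σ (List⁺ Carrier) λ B → ⋀ S B ⊑ b × All (λ b' → b ⊑ b' × ↑ (a ∷ as) b') (toList B)
    decompose a []        {b} a⊑b = b ∷ [] , refl , (refl , ↑-here a⊑b) ∷ []
    decompose a (a' ∷ as) {b} ⋀A⊑b =
      let x , y , a⊑x , ⋀as⊑y , x∧y≈b = distrib a (⋀ S (a' ∷ as)) b ⋀A⊑b
          R , ⋀R⊑y , R-above = decompose a' as ⋀as⊑y
          b⊑x∧y = reflexive (Eq.sym x∧y≈b)
      in x ∷ toList R ,
         trans (∧-monotonic refl ⋀R⊑y) (reflexive x∧y≈b) ,
         (trans b⊑x∧y (x∧y≤x x y) , ↑-here a⊑x) ∷
           All.map (λ (y⊑r , r∈↑as) → trans (trans b⊑x∧y (x∧y≤y x y)) y⊑r , ↑-there r∈↑as) R-above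

  refine : ∀ C A → All (⋀ S A ⊑_) (toList C) →
    Σ (List⁺ Carrier) λ C' → ⋀ S C' ⊑ ⋀ S C × All (λ c' → ↑ C c' × ↑ A c') (toList C')
  refine (c ∷ []) A (⋀A⊑c ∷ []) =
    let B , ⋀B⊑c , B-above = ⋀-decompose A ⋀A⊑c
    in B , ⋀B⊑c , All.map (λ (c⊑b , b∈↑A) → ↑-here c⊑b , b∈↑A) B-above
  refine (c ∷ c' ∷ cs) A (⋀A⊑c ∷ ⋀A⊑cs) =
    let B , ⋀B⊑c , B-above = ⋀-decompose A ⋀A⊑c
        R , ⋀R⊑⋀cs , R-above = refine (c' ∷ cs) A ⋀A⊑cs
    in B ⁺++⁺ R ,
       trans (⋀-⁺++⁺ B R) (∧-monotonic ⋀B⊑c ⋀R⊑⋀cs) ,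
       ++⁺ (All.map (λ (c⊑b , b∈↑A) → ↑-here c⊑b , b∈↑A) B-above)
           (All.map (λ (r∈↑cs , r∈↑A) → ↑-there r∈↑cs , r∈↑A) R-above)

  commonRefinement : ∀ b As → All (λ A → ⋀ S A ⊑ b) As →
    Σ (List⁺ Carrier) λ C → All (b ⊑_) (toList C) × ⋀ S C ⊑ b × All (λ A → All (↑ A) (toList C)) As
  commonRefinement b []       []             = b ∷ [] , refl ∷ [] , refl , []
  commonRefinement b (A ∷ As) (⋀A⊑b ∷ ⋀As⊑b) =
    let C , b⊑C , ⋀C⊑b , C-refines = commonRefinement b As ⋀As⊑b
        C' , ⋀C'⊑⋀C , C'-above = refine C A (All.map (trans ⋀A⊑b) b⊑C)
    in C' ,
       All.map (↑-lowerBound b⊑C ∘ proj₁) C'-above ,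
       trans ⋀C'⊑⋀C ⋀C⊑b ,
       All.map proj₂ C'-above ∷ All.map (λ C⊆↑A' → All.map (↑-trans C⊆↑A' ∘ proj₁) C'-above) C-refines

module Characterisation {c ℓ₁ ℓ₂ ℓ} (S : MeetSemilattice c ℓ₁ ℓ₂) (distrib : IsDistributive S)
  (n : ℕ) (1≤n : 1 ≤ n) (U : Pred (MeetSemilattice.Carrier S) ℓ) (U-upset : IsUpset S U) where
  open MeetSemilattice S renaming (_≤_ to _⊑_)
  open MeetProperties S
  open DistributiveProperties S distrib

  AdmissibleMeetBelow : Pred Carrier (c ⊔ ℓ₂ ⊔ ℓ)
  AdmissibleMeetBelow a =
    Σ (List⁺ Carrier) λ X → All U (toList X) × SmallMeetsIn S n U X × ⋀ S X ⊑ a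

  AdmissibleMeet : Pred Carrier (c ⊔ ℓ₁ ⊔ ℓ)
  AdmissibleMeet a =
    Σ (List⁺ Carrier) λ X → All U (toList X) × SmallMeetsIn S n U X × ⋀ S X ≈ a

  module Closure (X : List⁺ Carrier) (small : SmallMeetsIn S n AdmissibleMeetBelow X) where
    k : ℕ
    k = length (toList X)

    x : Fin k → Carrier
    x = lookup (toList X)

    -- A word over the indices names a subset of X; X itself is a junk value for words that
    -- are empty or too long.
    witness : List (Fin k) → List⁺ Carrier
    witness []      = X
    witness (i ∷ l) with length (i ∷ l) ≤? n
    ... | yes short = proj₁ (small (x i ∷ map x l) (∈-lookup i ∷ map⁺ (All.universal ∈-lookup l))
                                   (≤-trans (≤-reflexive (cong suc (length-map x l))) short))
    ... | no _      = X

    witness-spec : ∀ {j l} → j ∈ l → length l ≤ n →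
      SmallMeetsIn S n U (witness l) × ⋀ S (witness l) ⊑ x j
    witness-spec {j} {i ∷ l} j∈l short with length (i ∷ l) ≤? n
    ... | no long = contradiction short long
    ... | yes _   = let (_ , smallV , ⋀V⊑⋀Y) = proj₂ (small _ _ _)
                    in smallV , trans ⋀V⊑⋀Y (⋀-lowerBound (x i ∷ map x l) (∈-map⁺ x j∈l))

    relevant? : (j : Fin k) → Decidable (λ l → j ∈ l × length l ≤ n)
    relevant? j l = any? (j ≟_) l ×-dec (length l ≤? n)

    requirements : Fin k → List (List⁺ Carrier)
    requirements j = map witness (filter (relevant? j) (words (allFin k) n))

    requirements-below : ∀ j → All (λ A → ⋀ S A ⊑ x j) (requirements j)
    requirements-below j =
      map⁺ (All.tabulate λ l∈ →
        let (j∈l , short) = proj₂ (∈-filter⁻ (relevant? j) {xs = words (allFin k) n} l∈)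
        in proj₂ (witness-spec j∈l short))

    witness∈requirements : ∀ {j l} → j ∈ l → length l ≤ n → witness l ∈ requirements j
    witness∈requirements {j} {l} j∈l short =
      ∈-map⁺ witness (∈-filter⁺ (relevant? j)
        (∈-words (allFin k) n (All.universal (λ i → ∈-allFin i) l) short) (j∈l , short))

    refinement : Fin k → List⁺ Carrier
    refinement j = proj₁ (commonRefinement (x j) (requirements j) (requirements-below j))

    ⋀-refinement : ∀ j → ⋀ S (refinement j) ⊑ x j
    ⋀-refinement j = proj₁ (proj₂ (proj₂ (commonRefinement (x j) (requirements j) (requirements-below j))))

    refinement-↑ : ∀ {j l} → j ∈ l → length l ≤ n → All (↑ (witness l)) (toList (refinement j))
    refinement-↑ {j} j∈l short =
      All.lookup (proj₂ (proj₂ (proj₂ (commonRefinement (x j) (requirements j) (requirements-below j)))))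
                 (witness∈requirements j∈l short)

    Z : List⁺ Carrier
    Z = refinement fzero ⁺++ concatMap (toList ∘ refinement) (tabulate fsuc)

    ∈Z⁻ : ∀ {z} → z ∈ toList Z → ∃[ j ] z ∈ toList (refinement j)
    ∈Z⁻ z∈Z =
      let (j , _ , z∈) = find (∈-concatMap⁻ (toList ∘ refinement) {xs = allFin k} z∈Z) in j , z∈

    ∈Z⁺ : ∀ j {z} → z ∈ toList (refinement j) → z ∈ toList Z
    ∈Z⁺ j z∈ = ∈-concatMap⁺ (toList ∘ refinement) (lose (∈-allFin j) z∈)

    -- The at most n refinements met by W all lie above the witness of the word of their indices.
    Z-smallMeets : SmallMeetsIn S n U Z
    Z-smallMeets W W⊆Z |W|≤n =
      smallMeet-↑ U-upset (proj₁ (witness-spec j∈I |I|≤n)) W W⊆↑witness |W|≤n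
      where
      owners : All (λ w → ∃[ j ] w ∈ toList (refinement j)) (toList W)
      owners = All.map ∈Z⁻ W⊆Z
      I : List (Fin k)
      I = choices owners
      |I|≤n : length I ≤ n
      |I|≤n = ≤-trans (≤-reflexive (length-choices owners)) |W|≤n
      j∈I : proj₁ (All.head (choices-cover owners)) ∈ I
      j∈I = proj₁ (proj₂ (All.head (choices-cover owners)))
      W⊆↑witness : All (↑ (witness I)) (toList W)
      W⊆↑witness =
        All.map (λ (_ , j∈I , w∈) → All.lookup (refinement-↑ j∈I |I|≤n) w∈) (choices-cover owners)

    ⋀Z⊑⋀X : ⋀ S Z ⊑ ⋀ S X
    ⋀Z⊑⋀X = ⋀-greatest X (subst (All (⋀ S Z ⊑_)) (tabulate-lookup (toList X))
      (tabulate⁺ (λ j → trans (⋀-antitone Z (refinement j) (All.tabulate (∈Z⁺ j))) (⋀-refinement j))))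

    ⋀X-admissible : AdmissibleMeetBelow (⋀ S X)
    ⋀X-admissible = Z , smallMeetsIn⇒All 1≤n Z Z-smallMeets , Z-smallMeets , ⋀Z⊑⋀X

  AdmissibleMeetBelow-isNFilter : IsNFilter S n AdmissibleMeetBelow
  AdmissibleMeetBelow-isNFilter =
    (λ a⊑b (X , X⊆U , small , ⋀X⊑a) → X , X⊆U , small , trans ⋀X⊑a a⊑b) , Closure.⋀X-admissible

  U⊆AdmissibleMeetBelow : ∀ {u} → U u → AdmissibleMeetBelow u
  U⊆AdmissibleMeetBelow {u} u∈U = u ∷ [] , u∈U ∷ [] , small , refl
    where
    small : SmallMeetsIn S n U (u ∷ [])
    small Y Y⊆[u] _ = U-upset (⋀-greatest Y (All.map (λ { (here ≡.refl) → refl }) Y⊆[u])) u∈U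

  Fg⇒AdmissibleMeetBelow : ∀ {a} → Fg S n U a → AdmissibleMeetBelow a
  Fg⇒AdmissibleMeetBelow a∈Fg = a∈Fg AdmissibleMeetBelow AdmissibleMeetBelow-isNFilter U⊆AdmissibleMeetBelow

  AdmissibleMeetBelow⇒Fg : ∀ {a} → AdmissibleMeetBelow a → Fg S n U a
  AdmissibleMeetBelow⇒Fg (X , _ , small , ⋀X⊑a) F (F-upset , F-closed) U⊆F =
    F-upset ⋀X⊑a (F-closed X (λ Y Y⊆X |Y|≤n → U⊆F (small Y Y⊆X |Y|≤n)))

  AdmissibleMeetBelow⇒AdmissibleMeet : ∀ {a} → AdmissibleMeetBelow a → AdmissibleMeet a
  AdmissibleMeetBelow⇒AdmissibleMeet (X , X⊆U , small , ⋀X⊑a) =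
    let B , ⋀B⊑a , B-above = ⋀-decompose X ⋀X⊑a
    in B ,
       All.map (λ (_ , x , x∈X , x⊑b) → U-upset x⊑b (All.lookup X⊆U x∈X)) B-above ,
       (λ Y Y⊆B → smallMeet-↑ U-upset small Y (All.map (proj₂ ∘ All.lookup B-above) Y⊆B)) ,
       antisym ⋀B⊑a (⋀-greatest B (All.map proj₁ B-above))

  AdmissibleMeet⇒AdmissibleMeetBelow : ∀ {a} → AdmissibleMeet a → AdmissibleMeetBelow a
  AdmissibleMeet⇒AdmissibleMeetBelow (X , X⊆U , small , ⋀X≈a) = X , X⊆U , small , reflexive ⋀X≈a

mainTheorem1 : ∀ {c ℓ₁ ℓ₂ ℓ} (S : MeetSemilattice c ℓ₁ ℓ₂) → IsDistributive S →
    (n : ℕ) → 1 ≤ n → (U : Pred (MeetSemilattice.Carrier S) ℓ) → IsUpset S U →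
    (∀ a → Fg S n U a ⇔ (Σ (List⁺ (MeetSemilattice.Carrier S)) λ X →
    All U (toList X) × SmallMeetsIn S n U X × MeetSemilattice._≤_ S (⋀ S X) a))
    × (∀ a → Fg S n U a ⇔ (Σ (List⁺ (MeetSemilattice.Carrier S)) λ X →
    All U (toList X) × SmallMeetsIn S n U X × MeetSemilattice._≈_ S (⋀ S X) a))
mainTheorem1 S distrib n 1≤n U U-upset =
  (λ _ → mk⇔ Fg⇒AdmissibleMeetBelow AdmissibleMeetBelow⇒Fg) ,
  (λ _ → mk⇔ (AdmissibleMeetBelow⇒AdmissibleMeet ∘ Fg⇒AdmissibleMeetBelow)
             (AdmissibleMeetBelow⇒Fg ∘ AdmissibleMeet⇒AdmissibleMeetBelow))
  where open Characterisation S distrib n 1≤n U U-upset
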